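{- Let $G$ be a graph with at least one edge and let $x$ be a vertex of $G$ that is not isolated. Then there exists a Grundy total dominating sequence of $G$ that contains $x$.
   Context: For a vertex $v$, $N(v)$ is its open neighborhood. An open neighborhood sequence of $G$ is a sequence $(v_1,\ldots,v_k)$ of distinct vertices such that for each $i\in[k]$, $N(v_i)\setminus\bigcup_{j=1}^{i-1}N(v_j)\neq\emptyset$. A Grundy total dominating sequence is an open neighborhood sequence of maximum length. -}

module Defs where

open import Level using (0ℓ)
open import Data.Nat using (ℕ; _≤_)
open import Data.Fin using (Fin)
open import Data.List using (List; []; _∷_; _++_; [_]; length)
open import Data.List.Relation.Unary.All using (All)
open import Data.List.Relation.Unary.Unique.Propositional using (Unique)
open import Data.Product using (Σ; ∃; _×_)
open import Relation.Nullary using (¬_)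
open import Data.Unit using (⊤)
open import Relation.Binary using (Decidable)

record Graph (n : ℕ) : Set₁ where
  field
    Adj     : Fin n → Fin n → Set
    adj?    : Decidable Adj
    symm    : ∀ {u v} → Adj u v → Adj v u
    irrefl  : ∀ {u} → ¬ Adj u u
open Graph public

module _ {n : ℕ} (G : Graph n) where

  _∈N_ : Fin n → Fin n → Set
  u ∈N v = Adj G v u

  ONS-after : List (Fin n) → List (Fin n) → Set
  ONS-after prev []       = ⊤
  ONS-after prev (v ∷ vs) =
    (∃ λ u → u ∈N v × All (λ w → ¬ (u ∈N w)) prev) × ONS-after (prev ++ [ v ]) vs

  IsONS : List (Fin n) → Set
  IsONS s = Unique s × ONS-after [] s

  IsGrundyTD : List (Fin n) → Set
  IsGrundyTD s = IsONS s × (∀ t → IsONS t → length t ≤ length s)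

{-# OPTIONS --safe #-}
-- Start from any Grundy total dominating sequence s with x ∉ s and walk along it.  If x keeps
-- a footprint (a neighbour not dominated by the vertices before it) after every prefix of s,
-- then s followed by x is a longer open neighbourhood sequence, contradicting maximality.
-- Otherwise let v be the first vertex of s after which x has no footprint, so that N(x) is
-- covered by v together with its predecessors.  Replacing v by x is legal, since x still had a
-- footprint just before v, and it can only shrink the set of vertices dominated before each
-- later vertex, so their footprints survive.  This gives a sequence of the same length
-- containing x.
module Submission where

open import Defs
open import Data.Nat using (ℕ; zero; suc; _≤_; s≤s)
open import Data.Nat.Properties using (m+1+n≰m)
open import Data.Fin using (Fin)
open import Data.Fin.Properties using (any?; injective⇒≤; _≟_)
open import Data.List using (List; []; _∷_; _++_; [_]; length; map; concatMap; allFin; lookup; filter)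
open import Data.List.Properties using (length-++; length-++-sucʳ)
open import Data.List.Extrema.Nat using (argmax; argmax-all; f[xs]≤f[argmax])
open import Data.List.Membership.Propositional using (_∈_; _∉_)
open import Data.List.Membership.Propositional.Properties
  using (∈-map⁺; ∈-concatMap⁺; ∈-allFin; ∈-lookup; ∈-filter⁺; ∈-++⁺ʳ)
open import Data.List.Relation.Unary.All as All using (All; []; _∷_)
open import Data.List.Relation.Unary.All.Properties using (++⁺; ++⁻ˡ; ++⁻ʳ; ¬Any⇒All¬; all-filter)
open import Data.List.Relation.Unary.AllPairs using ([]; _∷_)
open import Data.List.Relation.Unary.Any as Any using (here; there)
open import Data.List.Relation.Unary.Unique.Propositional using (Unique)
import Data.List.Relation.Unary.Unique.DecPropositional as UniqueDec
import Data.List.Relation.Unary.Unique.Propositional.Properties as Unique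
open import Data.Product using (Σ; ∃; _×_; _,_; proj₁)
open import Data.Unit using (tt)
open import Data.Empty using (⊥-elim)
open import Function using (_∘_)
open import Relation.Nullary using (¬_; Dec; yes; no; ¬?)
open import Relation.Nullary.Decidable using (_×-dec_)
open import Relation.Unary using (Decidable)
open import Relation.Binary.PropositionalEquality using (_≡_; refl; sym; trans; cong; subst)

module _ {A : Set} where

  lookup-injective : ∀ {xs : List A} → Unique xs → ∀ {i j} → lookup xs i ≡ lookup xs j → i ≡ j
  lookup-injective (_ ∷ _)     {Fin.zero}  {Fin.zero}  _  = refl
  lookup-injective (x∉ ∷ _)    {Fin.zero}  {Fin.suc j} eq = ⊥-elim (All.lookup x∉ (∈-lookup j) eq)
  lookup-injective (x∉ ∷ _)    {Fin.suc i} {Fin.zero}  eq = ⊥-elim (All.lookup x∉ (∈-lookup i) (sym eq))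
  lookup-injective (_ ∷ uniq)  {Fin.suc i} {Fin.suc j} eq = cong Fin.suc (lookup-injective uniq eq)

  Unique-replace : ∀ as {v x : A} {bs} → x ∉ as ++ v ∷ bs → Unique (as ++ v ∷ bs) → Unique (as ++ x ∷ bs)
  Unique-replace []       x∉ (_ ∷ uniq)  = ¬Any⇒All¬ _ (x∉ ∘ there) ∷ uniq
  Unique-replace (a ∷ as) x∉ (a∉ ∷ uniq) =
    ++⁺ (++⁻ˡ as a∉) ((λ a≡x → x∉ (here (sym a≡x))) ∷ All.tail (++⁻ʳ as a∉))
    ∷ Unique-replace as (x∉ ∘ there) uniq

  Unique-snoc : ∀ {xs : List A} {x} → x ∉ xs → Unique xs → Unique (xs ++ [ x ])
  Unique-snoc x∉ uniq = Unique.++⁺ uniq ([] ∷ []) λ { (x∈ , here refl) → x∉ x∈ }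

  length-replace : ∀ as {v x : A} {bs} → length (as ++ v ∷ bs) ≡ length (as ++ x ∷ bs)
  length-replace as {v} {x} {bs} = trans (length-++-sucʳ as v bs) (sym (length-++-sucʳ as x bs))

  listsUpTo : List A → ℕ → List (List A)
  listsUpTo as zero    = [ [] ]
  listsUpTo as (suc m) = [] ∷ concatMap (λ a → map (a ∷_) (listsUpTo as m)) as

  ∈-listsUpTo : ∀ {as} m {t} → All (_∈ as) t → length t ≤ m → t ∈ listsUpTo as m
  ∈-listsUpTo zero    []         _       = here refl
  ∈-listsUpTo (suc m) []         _       = here refl
  ∈-listsUpTo (suc m) (a∈ ∷ t∈) (s≤s t≤m) =
    there (∈-concatMap⁺ _ (Any.map (λ { refl → ∈-map⁺ _ (∈-listsUpTo m t∈ t≤m) }) a∈))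

  maximise : ∀ {P : A → Set} → Decidable P → (f : A → ℕ) → (xs : List A) → ∀ {a} → P a →
             ∃ λ b → P b × (∀ {t} → t ∈ xs → P t → f t ≤ f b)
  maximise P? f xs {a} pa =
    argmax f a candidates , argmax-all f pa (all-filter P? xs) ,
    λ t∈ pt → All.lookup (f[xs]≤f[argmax] a candidates) (∈-filter⁺ P? t∈ pt)
    where candidates = filter P? xs

Unique⇒length≤ : ∀ {n} {xs : List (Fin n)} → Unique xs → length xs ≤ n
Unique⇒length≤ uniq = injective⇒≤ (lookup-injective uniq)

module _ {n : ℕ} (G : Graph n) where

  Undominated : List (Fin n) → Fin n → Set
  Undominated prev u = All (λ w → ¬ Adj G w u) prev

  Footprint : List (Fin n) → Fin n → Set
  Footprint prev v = ∃ λ u → Adj G v u × Undominated prev u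

  -- N(p') ⊆ N(p), stated contrapositively as it is used.
  _⊑_ : List (Fin n) → List (Fin n) → Set
  p' ⊑ p = ∀ {u} → Undominated p u → Undominated p' u

  footprint? : ∀ prev v → Dec (Footprint prev v)
  footprint? prev v = any? λ u → adj? G v u ×-dec All.all? (λ w → ¬? (adj? G w u)) prev

  ONS-after? : ∀ prev s → Dec (ONS-after G prev s)
  ONS-after? prev []       = yes tt
  ONS-after? prev (v ∷ vs) = footprint? prev v ×-dec ONS-after? (prev ++ [ v ]) vs

  IsONS? : Decidable (IsONS G)
  IsONS? s = UniqueDec.unique? _≟_ s ×-dec ONS-after? [] s

  grundyTD : Σ (List (Fin n)) (IsGrundyTD G)
  grundyTD with maximise IsONS? length (listsUpTo (allFin n) n) ([] , tt)
  ... | s , ons , maximal = s , ons , λ t ont → maximal (enumerated t (proj₁ ont)) ont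
    where
    enumerated : ∀ t → Unique t → t ∈ listsUpTo (allFin n) n
    enumerated t uniq = ∈-listsUpTo n (All.tabulate (λ {v} _ → ∈-allFin v)) (Unique⇒length≤ uniq)

  ONS-after-mono : ∀ {p p'} vs → p' ⊑ p → ONS-after G p vs → ONS-after G p' vs
  ONS-after-mono     []       _    _                      = tt
  ONS-after-mono {p} (v ∷ vs) p'⊑p ((u , vu , und) , rest) =
    (u , vu , p'⊑p und) , ONS-after-mono vs (λ und → ++⁺ (p'⊑p (++⁻ˡ p und)) (++⁻ʳ p und)) rest

  data Exchange (x : Fin n) (prev : List (Fin n)) : List (Fin n) → Set where
    append  : ∀ {s} → ONS-after G prev (s ++ [ x ]) → Exchange x prev s
    replace : ∀ as v bs → ONS-after G prev (as ++ x ∷ bs) → Exchange x prev (as ++ v ∷ bs)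

  exchange : ∀ {x} prev s → ONS-after G prev s → Footprint prev x → Exchange x prev s
  exchange prev []       _           fx = append (fx , tt)
  exchange {x} prev (v ∷ vs) (fv , rest) fx with footprint? (prev ++ [ v ]) x
  ... | no ¬fx′ = replace [] v vs (fx , ONS-after-mono vs swap rest)
    where
    swap : (prev ++ [ x ]) ⊑ (prev ++ [ v ])
    swap {u} und = ++⁺ (++⁻ˡ prev und) ((λ xu → ¬fx′ (u , xu , und)) ∷ [])
  ... | yes fx′ with exchange (prev ++ [ v ]) vs rest fx′
  ...   | append ons           = append (fv , ons)
  ...   | replace as w bs ons  = replace (v ∷ as) w bs (fv , ons)

proposition5p1 : (n : ℕ) (G : Graph n)
    → (∃ λ u → ∃ λ v → Adj G u v)
    → (x : Fin n) → (∃ λ y → Adj G x y)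
    → Σ (List (Fin n)) λ s → IsGrundyTD G s × x ∈ s
-- The edge hypothesis is implied by the neighbour y of x.
proposition5p1 n G _ x (y , xy) with grundyTD G
... | s , ons@(uniq , after) , maximal with Any.any? (x ≟_) s
... | yes x∈s = s , (ons , maximal) , x∈s
... | no x∉s with exchange G [] s after (y , xy , [])
... | append after′ =
  ⊥-elim (m+1+n≰m (length s) (subst (_≤ length s) (length-++ s) (maximal _ (Unique-snoc x∉s uniq , after′))))
... | replace as v bs after′ =
  as ++ x ∷ bs ,
  ((Unique-replace as x∉s uniq , after′) , λ t ont → subst (length t ≤_) (length-replace as) (maximal t ont)) ,
  ∈-++⁺ʳ as (here refl)
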